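{- Let $3\le p<q$ be relatively prime integers, let $s$ be an integer with $3\le s<q$ and $\gcd(s,pq)=1$, and put $r=pq+s$. For all integers $k,\gamma,\beta$ with $|k|<pq$, $0\le\gamma<s$, and $|\beta|\le\lfloor pq/s\rfloor$, \[ \sigma_s(kr+\gamma+\beta pq)-\chi(kr+\beta pq)=\sigma'_s(ks+\gamma)-\chi'(ks)=\sigma'_s(ks+\gamma-pq). \]
   Context: For pairwise relatively prime integers $p,q,t\ge 3$, every integer $n$ has a unique representation $n=x_nqt+y_ntp+z_npq+\delta_npqt$ with $0\le x_n<p$, $0\le y_n<q$, $0\le z_n<t$, $\delta_n\in\mathbb Z$; $n$ is called $\{p,q,t\}$-representable if $\delta_n\ge 0$. Here $\chi$ is the characteristic function of $\{p,q,r\}$-representable integers and $\chi'$ is the characteristic function of $\{p,q,s\}$-representable integers. For a positive integer $k$, $\sigma_k(m)=\sum_{m-k<n\le m}\chi(n)$ and $\sigma'_k(m)=\sum_{m-k<n\le m}\chi'(n)$. -}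

module Defs where

open import Data.Nat as ℕ using (ℕ; zero; suc)
open import Data.Nat.Divisibility using (_∣?_)
open import Data.Integer as ℤ using (ℤ; +_; -[1+_])
open import Data.List using (List; upTo)
open import Data.Bool.ListAction using (any)
open import Data.Bool using (Bool; true; false; if_then_else_; _∧_)
open import Relation.Nullary.Decidable using (⌊_⌋)

okTriple : ℕ → ℕ → ℕ → ℤ → ℕ → ℕ → ℕ → Bool
okTriple p q t n x y z with n ℤ.- (+ (x ℕ.* q ℕ.* t ℕ.+ y ℕ.* t ℕ.* p ℕ.+ z ℕ.* p ℕ.* q))
... | + m = ⌊ (p ℕ.* q ℕ.* t) ∣? m ⌋
... | -[1+ _ ] = false

-- n is {p,q,t}-representable: its representation
-- n = x_n q t + y_n t p + z_n p q + δ_n p q t (0 ≤ x_n < p, 0 ≤ y_n < q, 0 ≤ z_n < t)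
-- has δ_n ≥ 0.
Representable? : ℕ → ℕ → ℕ → ℤ → Bool
Representable? p q t n =
  any (λ x → any (λ y → any (λ z → okTriple p q t n x y z) (upTo t)) (upTo q)) (upTo p)

χ : ℕ → ℕ → ℕ → ℤ → ℕ
χ p q t n = if Representable? p q t n then 1 else 0

-- σ_k(m) = Σ_{m-k < n ≤ m} χ(n) = Σ_{i < k} χ(m - i)
σ : ℕ → ℕ → ℕ → ℕ → ℤ → ℕ
σ p q t zero m = 0
σ p q t (suc k) m = χ p q t (m ℤ.- + k) ℕ.+ σ p q t k m

module Submission where

-- Key fact (χ-scaled): for t coprime to P = p q and a base-t digit 0 ≤ Z < t, the integer
-- t u + Z P is {p,q,t}-representable iff u is {p,q}-representable, independently of t and Z.
-- Every offset 0 < |j| < s can be written j = w P - s m with a digit 1 ≤ w < s (Bézout), which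
-- puts k r + β P + j, k s + j and k s - P + j into that form with the common u = k - m
-- (χ-offset-lift, χ-offset-shift); meanwhile k s - P = s (k - P) + (s - 1) P with k - P < 0
-- (χ-below-vanishes).  A window-exchange lemma for σ then gives both equalities.

open import Defs
open import Data.Nat as ℕ using (ℕ; zero; suc; NonZero; z≤n; s≤s)
import Data.Nat.Properties as ℕP
open import Data.Nat.Divisibility using (_∣_; divides; >⇒∤)
open import Data.Nat.DivMod using (m/n*n≤m)
open import Data.Nat.Coprimality using (Coprime; coprime-divisor; coprime-Bézout; coprime-+)
open import Data.Nat.GCD using (module Bézout)
open import Data.Integer as ℤ
  using (ℤ; +_; -[1+_]; ∣_∣; 0ℤ; 1ℤ; _+_; _-_; _*_; -_; _≤_; _<_; +≤+; +<+; -<+; -<-)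
import Data.Integer.Properties as ℤP
import Data.Integer.DivMod as ℤD
import Data.Integer.Tactic.RingSolver as ℤRing
import Data.Nat.Tactic.RingSolver as ℕRing
open import Data.Bool using (true; false; T)
open import Data.List.Relation.Unary.Any.Properties using (any⁺; any⁻)
open import Data.List.Membership.Propositional using (find; lose)
open import Data.List.Membership.Propositional.Properties using (∈-upTo⁺; ∈-upTo⁻)
open import Relation.Nullary.Decidable using (toWitness; fromWitness)
open import Relation.Nullary using (¬_; yes; no)
open import Data.Product using (_×_; _,_; ∃-syntax; proj₁; proj₂)
open import Data.Sum using ([_,_]′)
open import Data.Empty using (⊥; ⊥-elim)
open import Function using (_∘_; id)
open import Relation.Binary.PropositionalEquality

record Representation (p q t : ℕ) (n : ℤ) : Set where
  constructor representation
  field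
    x y z δ : ℕ
    x<p : x ℕ.< p
    y<q : y ℕ.< q
    z<t : z ℕ.< t
    n≡ : n ≡ + (x ℕ.* q ℕ.* t ℕ.+ y ℕ.* t ℕ.* p ℕ.+ z ℕ.* p ℕ.* q) + + (δ ℕ.* (p ℕ.* q ℕ.* t))

-≡⇒≡+ : ∀ a b c → a - b ≡ c → a ≡ b + c
-≡⇒≡+ a b _ refl = ring a b
  where
  ring : ∀ a b → a ≡ b + (a - b)
  ring = ℤRing.solve-∀

≡+⇒-≡ : ∀ a b c → a ≡ b + c → a - b ≡ c
≡+⇒-≡ _ b c refl = ring b c
  where
  ring : ∀ b c → b + c - b ≡ c
  ring = ℤRing.solve-∀

okTriple-sound : ∀ p q t n x y z → T (okTriple p q t n x y z) →
  ∃[ δ ] n ≡ + (x ℕ.* q ℕ.* t ℕ.+ y ℕ.* t ℕ.* p ℕ.+ z ℕ.* p ℕ.* q) + + (δ ℕ.* (p ℕ.* q ℕ.* t))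
okTriple-sound p q t n x y z ok with n - + (x ℕ.* q ℕ.* t ℕ.+ y ℕ.* t ℕ.* p ℕ.+ z ℕ.* p ℕ.* q) in rest
... | + m with divides δ m≡δpqt ← toWitness ok = δ , -≡⇒≡+ _ _ _ (trans rest (cong +_ m≡δpqt))

okTriple-complete : ∀ p q t n x y z δ →
  n ≡ + (x ℕ.* q ℕ.* t ℕ.+ y ℕ.* t ℕ.* p ℕ.+ z ℕ.* p ℕ.* q) + + (δ ℕ.* (p ℕ.* q ℕ.* t)) →
  T (okTriple p q t n x y z)
okTriple-complete p q t n x y z δ n≡
  with ≡+⇒-≡ n (+ (x ℕ.* q ℕ.* t ℕ.+ y ℕ.* t ℕ.* p ℕ.+ z ℕ.* p ℕ.* q)) _ n≡
... | rest with n - + (x ℕ.* q ℕ.* t ℕ.+ y ℕ.* t ℕ.* p ℕ.+ z ℕ.* p ℕ.* q)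
...   | + m = fromWitness (divides δ (ℤP.+-injective rest))

representable-sound : ∀ p q t n → T (Representable? p q t n) → Representation p q t n
representable-sound p q t n ok
  with x , x∈ , ok₁ ← find (any⁻ _ _ ok)
  with y , y∈ , ok₂ ← find (any⁻ _ _ ok₁)
  with z , z∈ , ok₃ ← find (any⁻ _ _ ok₂)
  with δ , n≡ ← okTriple-sound p q t n x y z ok₃
  = representation x y z δ (∈-upTo⁻ x∈) (∈-upTo⁻ y∈) (∈-upTo⁻ z∈) n≡

representable-complete : ∀ p q t n → Representation p q t n → T (Representable? p q t n)
representable-complete p q t n (representation x y z δ x<p y<q z<t n≡) =
  any⁺ _ (lose (∈-upTo⁺ x<p) (any⁺ _ (lose (∈-upTo⁺ y<q) (any⁺ _ (lose (∈-upTo⁺ z<t)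
    (okTriple-complete p q t n x y z δ n≡))))))

χ-cong : ∀ {p q t t' n n'} →
  (Representation p q t n → Representation p q t' n') →
  (Representation p q t' n' → Representation p q t n) →
  χ p q t n ≡ χ p q t' n'
χ-cong {p} {q} {t} {t'} {n} {n'} to from
  with Representable? p q t n in ok | Representable? p q t' n' in ok'
... | true  | true  = refl
... | false | false = refl
... | true  | false = ⊥-elim (subst T ok' (representable-complete p q t' n'
                        (to (representable-sound p q t n (subst T (sym ok) _)))))
... | false | true  = ⊥-elim (subst T ok (representable-complete p q t n
                        (from (representable-sound p q t' n' (subst T (sym ok') _)))))

χ-≡0 : ∀ {p q t n} → ¬ Representation p q t n → χ p q t n ≡ 0
χ-≡0 {p} {q} {t} {n} ¬rep with Representable? p q t n in ok
... | false = refl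
... | true  = ⊥-elim (¬rep (representable-sound p q t n (subst T (sym ok) _)))

record Representation₂ (p q : ℕ) (u : ℤ) : Set where
  constructor representation₂
  field
    x y δ : ℕ
    x<p : x ℕ.< p
    y<q : y ℕ.< q
    u≡ : u ≡ + (x ℕ.* q ℕ.+ y ℕ.* p ℕ.+ δ ℕ.* (p ℕ.* q))

Digit : ℕ → ℤ → Set
Digit t Z = 0ℤ ≤ Z × Z < + t

multiple-below≡0 : ∀ {t d} → t ∣ d → d ℕ.< t → d ≡ 0
multiple-below≡0 {d = zero}  _   _   = refl
multiple-below≡0 {d = suc _} t∣d d<t = ⊥-elim (>⇒∤ d<t t∣d)

distance-< : ∀ {m n t} → m ℕ.< t → n ℕ.< t → ∣ + m - + n ∣ ℕ.< t
distance-< {m} {n} m<t n<t = ℕP.≤-<-trans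
  (subst (ℕ._≤ m ℕ.⊔ n) (cong ∣_∣ (sym (ℤP.[+m]-[+n]≡m⊖n m n))) (ℤP.∣m⊝n∣≤m⊔n m n))
  (ℕP.⊔-pres-<m m<t n<t)

-- If gcd(t, P) = 1, then t u + z P = t w + z' P with digits z, z' < t forces u = w:
-- t (u - w) = (z' - z) P makes t divide |z' - z| < t.
coprime-digit-cancel : ∀ {t P} u w z z' → Coprime t P → z ℕ.< t → z' ℕ.< t →
  + t * u + + z * + P ≡ + t * w + + z' * + P → u ≡ w
coprime-digit-cancel {t} {P} u w z z' t⊥P z<t z'<t eq = ℤP.i-j≡0⇒i≡j u w u-w≡0
  where
  open ≡-Reasoning
  d : ℤ
  d = + z' - + z

  scaled-difference : + t * (u - w) ≡ d * + P
  scaled-difference = begin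
    + t * (u - w)                                          ≡⟨ ring₁ (+ t) u w (+ z) (+ P) ⟩
    (+ t * u + + z * + P) - (+ t * w + + z * + P)          ≡⟨ cong (_- (+ t * w + + z * + P)) eq ⟩
    (+ t * w + + z' * + P) - (+ t * w + + z * + P)         ≡⟨ ring₂ (+ t) w (+ z) (+ z') (+ P) ⟩
    d * + P                                                ∎
    where
    ring₁ : ∀ T u w Z P → T * (u - w) ≡ (T * u + Z * P) - (T * w + Z * P)
    ring₁ = ℤRing.solve-∀
    ring₂ : ∀ T w Z Z' P → (T * w + Z' * P) - (T * w + Z * P) ≡ (Z' - Z) * P
    ring₂ = ℤRing.solve-∀

  t∣d : t ∣ ∣ d ∣
  t∣d = coprime-divisor t⊥P (divides ∣ u - w ∣ (begin
    P ℕ.* ∣ d ∣          ≡⟨ ℕP.*-comm P ∣ d ∣ ⟩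
    ∣ d ∣ ℕ.* P          ≡⟨ ℤP.abs-* d (+ P) ⟨
    ∣ d * + P ∣          ≡⟨ cong ∣_∣ scaled-difference ⟨
    ∣ + t * (u - w) ∣    ≡⟨ ℤP.abs-* (+ t) (u - w) ⟩
    t ℕ.* ∣ u - w ∣      ≡⟨ ℕP.*-comm t ∣ u - w ∣ ⟩
    ∣ u - w ∣ ℕ.* t      ∎))

  d≡0 : d ≡ 0ℤ
  d≡0 = ℤP.∣i∣≡0⇒i≡0 (multiple-below≡0 t∣d (distance-< z'<t z<t))

  t[u-w]≡0 : + t * (u - w) ≡ 0ℤ
  t[u-w]≡0 = begin
    + t * (u - w)  ≡⟨ scaled-difference ⟩
    d * + P        ≡⟨ cong (_* + P) d≡0 ⟩
    0ℤ * + P       ≡⟨ ℤP.*-zeroˡ (+ P) ⟩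
    0ℤ             ∎

  u-w≡0 : u - w ≡ 0ℤ
  u-w≡0 = [ (λ t≡0 → ⊥-elim (ℕP.<⇒≢ (ℕP.≤-<-trans z≤n z<t) (sym (ℤP.+-injective t≡0)))) , id ]′
    (ℤP.i*j≡0⇒i≡0∨j≡0 (+ t) t[u-w]≡0)

representation-regroup : ∀ p q t x y z δ →
  + (x ℕ.* q ℕ.* t ℕ.+ y ℕ.* t ℕ.* p ℕ.+ z ℕ.* p ℕ.* q) + + (δ ℕ.* (p ℕ.* q ℕ.* t))
    ≡ + t * + (x ℕ.* q ℕ.+ y ℕ.* p ℕ.+ δ ℕ.* (p ℕ.* q)) + + z * + (p ℕ.* q)
representation-regroup p q t x y z δ = begin
  + (x ℕ.* q ℕ.* t ℕ.+ y ℕ.* t ℕ.* p ℕ.+ z ℕ.* p ℕ.* q ℕ.+ δ ℕ.* (p ℕ.* q ℕ.* t))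
    ≡⟨ cong +_ (ring p q t x y z δ) ⟩
  + (t ℕ.* w ℕ.+ z ℕ.* (p ℕ.* q))
    ≡⟨ cong₂ _+_ (ℤP.pos-* t w) (ℤP.pos-* z (p ℕ.* q)) ⟩
  + t * + w + + z * + (p ℕ.* q) ∎
  where
  open ≡-Reasoning
  w : ℕ
  w = x ℕ.* q ℕ.+ y ℕ.* p ℕ.+ δ ℕ.* (p ℕ.* q)
  ring : ∀ p q t x y z δ →
    x ℕ.* q ℕ.* t ℕ.+ y ℕ.* t ℕ.* p ℕ.+ z ℕ.* p ℕ.* q ℕ.+ δ ℕ.* (p ℕ.* q ℕ.* t)
      ≡ t ℕ.* (x ℕ.* q ℕ.+ y ℕ.* p ℕ.+ δ ℕ.* (p ℕ.* q)) ℕ.+ z ℕ.* (p ℕ.* q)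
  ring = ℕRing.solve-∀

scaled-representation⇒ : ∀ {p q t} u z → Coprime t (p ℕ.* q) → z ℕ.< t →
  Representation p q t (+ t * u + + z * + (p ℕ.* q)) → Representation₂ p q u
scaled-representation⇒ u z t⊥pq z<t (representation x y z' δ x<p y<q z'<t n≡) =
  representation₂ x y δ x<p y<q
    (coprime-digit-cancel u _ z z' t⊥pq z<t z'<t (trans n≡ (representation-regroup _ _ _ x y z' δ)))

scaled-representation⇐ : ∀ {p q t} u z → z ℕ.< t →
  Representation₂ p q u → Representation p q t (+ t * u + + z * + (p ℕ.* q))
scaled-representation⇐ {t = t} u z z<t (representation₂ x y δ x<p y<q refl) =
  representation x y z δ x<p y<q z<t (sym (representation-regroup _ _ t x y z δ))

χ-scaled : ∀ p q {t t' Z Z'} u → Coprime t (p ℕ.* q) → Coprime t' (p ℕ.* q) →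
  Digit t Z → Digit t' Z' →
  χ p q t (+ t * u + Z * + (p ℕ.* q)) ≡ χ p q t' (+ t' * u + Z' * + (p ℕ.* q))
χ-scaled p q u t⊥pq t'⊥pq (+≤+ {n = z} _ , +<+ z<t) (+≤+ {n = z'} _ , +<+ z'<t') = χ-cong {p} {q}
  (scaled-representation⇐ u z' z'<t' ∘ scaled-representation⇒ u z t⊥pq z<t)
  (scaled-representation⇐ u z z<t ∘ scaled-representation⇒ u z' t'⊥pq z'<t')

χ-scaled-negative : ∀ p q {t Z} u → Coprime t (p ℕ.* q) → Digit t Z → u < 0ℤ →
  χ p q t (+ t * u + Z * + (p ℕ.* q)) ≡ 0
χ-scaled-negative p q u t⊥pq (+≤+ {n = z} _ , +<+ z<t) u<0 = χ-≡0 {p} {q} λ rep →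
  let representation₂ _ _ _ _ _ u≡ = scaled-representation⇒ u z t⊥pq z<t rep
  in ℤP.<⇒≱ u<0 (subst (0ℤ ≤_) (sym u≡) (+≤+ z≤n))

inverse-modulo : ∀ {s P} → Coprime s P → ∃[ c ] ∃[ e ] c * + P ≡ 1ℤ + + s * e
inverse-modulo {s} {P} s⊥P with coprime-Bézout s⊥P
... | Bézout.+- x y 1+yP≡xs = - + y , - + x , (begin
  - + y * + P              ≡⟨ ring₁ (+ y) (+ P) ⟩
  1ℤ - (1ℤ + + y * + P)    ≡⟨ cong (λ a → 1ℤ - (1ℤ + a)) (ℤP.pos-* y P) ⟨
  1ℤ - + (1 ℕ.+ y ℕ.* P)   ≡⟨ cong (λ a → 1ℤ - + a) 1+yP≡xs ⟩
  1ℤ - + (x ℕ.* s)         ≡⟨ cong (λ a → 1ℤ - a) (ℤP.pos-* x s) ⟩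
  1ℤ - + x * + s           ≡⟨ ring₂ (+ x) (+ s) ⟩
  1ℤ + + s * - + x         ∎)
  where
  open ≡-Reasoning
  ring₁ : ∀ Y P → - Y * P ≡ 1ℤ - (1ℤ + Y * P)
  ring₁ = ℤRing.solve-∀
  ring₂ : ∀ X S → 1ℤ - X * S ≡ 1ℤ + S * - X
  ring₂ = ℤRing.solve-∀
... | Bézout.-+ x y 1+xs≡yP = + y , + x , (begin
  + y * + P                ≡⟨ ℤP.pos-* y P ⟨
  + (y ℕ.* P)              ≡⟨ cong +_ 1+xs≡yP ⟨
  + (1 ℕ.+ x ℕ.* s)        ≡⟨ cong (λ a → 1ℤ + a) (ℤP.pos-* x s) ⟩
  1ℤ + + x * + s           ≡⟨ cong (λ a → 1ℤ + a) (ℤP.*-comm (+ x) (+ s)) ⟩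
  1ℤ + + s * + x           ∎)
  where open ≡-Reasoning

residue : ∀ {s P} .{{_ : NonZero s}} → Coprime s P →
  ∀ j → ∃[ z ] ∃[ m ] z ℕ.< s × j ≡ + z * + P - + s * m
residue {s} {P} s⊥P j with c , e , cP≡1+se ← inverse-modulo s⊥P =
  z , j * e - d * + P , ℤD.n%ℕd<d (c * j) s , sym (begin
    + z * + P - + s * (j * e - d * + P)     ≡⟨ ring₁ (+ z) d (+ s) j e (+ P) ⟩
    (+ z + d * + s) * + P - j * (+ s * e)   ≡⟨ cong (λ a → a * + P - j * (+ s * e)) (ℤD.a≡a%ℕn+[a/ℕn]*n (c * j) s) ⟨
    c * j * + P - j * (+ s * e)             ≡⟨ ring₂ c j (+ P) (+ s) e ⟩
    j * (c * + P) - j * (+ s * e)           ≡⟨ cong (λ a → j * a - j * (+ s * e)) cP≡1+se ⟩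
    j * (1ℤ + + s * e) - j * (+ s * e)      ≡⟨ ring₃ j (+ s) e ⟩
    j                                       ∎)
  where
  open ≡-Reasoning
  z : ℕ
  z = (c * j) ℤD.%ℕ s
  d : ℤ
  d = (c * j) ℤD./ℕ s
  ring₁ : ∀ Z d S j e P → Z * P - S * (j * e - d * P) ≡ (Z + d * S) * P - j * (S * e)
  ring₁ = ℤRing.solve-∀
  ring₂ : ∀ c j P S e → c * j * P - j * (S * e) ≡ j * (c * P) - j * (S * e)
  ring₂ = ℤRing.solve-∀
  ring₃ : ∀ j S e → j * (1ℤ + S * e) - j * (S * e) ≡ j
  ring₃ = ℤRing.solve-∀

-- For 0 < |j| < s the digit is nonzero: z = 0 would make |j| = s |m| a multiple of s.
residue-nonzero : ∀ {s P} .{{_ : NonZero s}} → Coprime s P →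
  ∀ j → j ≢ 0ℤ → ∣ j ∣ ℕ.< s → ∃[ z ] ∃[ m ] suc z ℕ.< s × j ≡ + suc z * + P - + s * m
residue-nonzero {s} {P} s⊥P j j≢0 ∣j∣<s = nonzero-digit (residue s⊥P j)
  where
  nonzero-digit : (∃[ z ] ∃[ m ] z ℕ.< s × j ≡ + z * + P - + s * m) →
    ∃[ z ] ∃[ m ] suc z ℕ.< s × j ≡ + suc z * + P - + s * m
  nonzero-digit (suc z , m , z<s , j≡) = z , m , z<s , j≡
  nonzero-digit (zero  , m , _   , j≡) = ⊥-elim (not-multiple ∣ m ∣ ∣j∣≡s∣m∣)
    where
      open ≡-Reasoning
      ∣j∣≡s∣m∣ : ∣ j ∣ ≡ s ℕ.* ∣ m ∣
      ∣j∣≡s∣m∣ = begin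
        ∣ j ∣               ≡⟨ cong ∣_∣ j≡ ⟩
        ∣ 0ℤ - + s * m ∣    ≡⟨ cong ∣_∣ (ℤP.+-identityˡ (- (+ s * m))) ⟩
        ∣ - (+ s * m) ∣     ≡⟨ ℤP.∣-i∣≡∣i∣ (+ s * m) ⟩
        ∣ + s * m ∣         ≡⟨ ℤP.abs-* (+ s) m ⟩
        s ℕ.* ∣ m ∣         ∎
      not-multiple : ∀ k → ∣ j ∣ ≡ s ℕ.* k → ⊥
      not-multiple zero    ∣j∣≡0 = j≢0 (ℤP.∣i∣≡0⇒i≡0 (trans ∣j∣≡0 (ℕP.*-zeroʳ s)))
      not-multiple (suc k) ∣j∣≡sk = ℕP.<⇒≱ ∣j∣<s (subst (s ℕ.≤_) (sym ∣j∣≡sk) (ℕP.m≤m*n s (suc k)))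

abs-bounds : ∀ {i n} → ∣ i ∣ ℕ.< n → - + n < i × i < + n
abs-bounds {+ _}      {suc _} k<n         = -<+ , +<+ k<n
abs-bounds { -[1+ _ ]} {suc _} (s≤s k<n) = -<- k<n , -<+

shift-between : ∀ {E R w s} → ∣ E ∣ ℕ.< R → suc w ℕ.< s →
  0ℤ < E + + (suc w ℕ.* R) × E + + (suc w ℕ.* R) < + (s ℕ.* R)
shift-between {E} {R} {w} {s} ∣E∣<R w<s = lower , upper
  where
  open ℤP.≤-Reasoning
  wR : ℕ
  wR = suc w ℕ.* R
  lower : 0ℤ < E + + wR
  lower = begin-strict
    0ℤ           ≡⟨ ℤP.+-inverseˡ (+ R) ⟨
    - + R + + R  <⟨ ℤP.+-monoˡ-< (+ R) (proj₁ (abs-bounds {E} ∣E∣<R)) ⟩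
    E + + R      ≤⟨ ℤP.+-monoʳ-≤ E (+≤+ (ℕP.m≤n*m R (suc w))) ⟩
    E + + wR     ∎
  upper : E + + wR < + (s ℕ.* R)
  upper = begin-strict
    E + + wR          <⟨ ℤP.+-monoˡ-< (+ wR) (proj₂ (abs-bounds {E} ∣E∣<R)) ⟩
    + (R ℕ.+ wR)      ≤⟨ +≤+ (ℕP.*-monoˡ-≤ R w<s) ⟩
    + (s ℕ.* R)       ∎

-- With j = (w+1) P - s m, |j| < s, w + 1 < s and |β| ≤ ⌊P/s⌋, the integer β + m + (w+1)
-- is a base-(P + s) digit: s (β + m + w + 1) = (s β - j) + (w+1)(P + s), where |s β - j| < P + s.
carry-digit : ∀ {s} .{{_ : NonZero s}} P β m w j → ∣ β ∣ ℕ.≤ P ℕ./ s → ∣ j ∣ ℕ.< s → suc w ℕ.< s →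
  j ≡ + suc w * + P - + s * m → Digit (P ℕ.+ s) (β + m + + suc w)
carry-digit {s} P β m w j ∣β∣≤P/s ∣j∣<s 1+w<s j≡ =
  ℤP.<⇒≤ (ℤP.*-cancelˡ-<-nonNeg (+ s) s*0<s*Z) , ℤP.*-cancelˡ-<-nonNeg (+ s) s*Z<s*R
  where
  open ℤP.≤-Reasoning
  R : ℕ
  R = P ℕ.+ s
  Z E : ℤ
  Z = β + m + + suc w
  E = + s * β - j

  ∣sβ∣≤P : ∣ + s * β ∣ ℕ.≤ P
  ∣sβ∣≤P = ℕP.≤-trans (ℕP.≤-reflexive (ℤP.abs-* (+ s) β))
    (ℕP.≤-trans (ℕP.*-monoʳ-≤ s ∣β∣≤P/s) (ℕP.≤-trans (ℕP.≤-reflexive (ℕP.*-comm s (P ℕ./ s))) (m/n*n≤m P s)))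

  ∣E∣<R : ∣ E ∣ ℕ.< R
  ∣E∣<R = ℕP.≤-<-trans (ℤP.∣i-j∣≤∣i∣+∣j∣ (+ s * β) j) (ℕP.+-mono-≤-< ∣sβ∣≤P ∣j∣<s)

  s*Z≡ : + s * Z ≡ E + + (suc w ℕ.* R)
  s*Z≡ = trans (ring (+ s) β m (+ suc w) (+ P))
    (cong₂ (λ i a → + s * β - i + a) (sym j≡) (sym (ℤP.pos-* (suc w) R)))
    where
    ring : ∀ S β m W P → S * (β + m + W) ≡ S * β - (W * P - S * m) + W * (P + S)
    ring = ℤRing.solve-∀

  s*0<s*Z : + s * 0ℤ < + s * Z
  s*0<s*Z = begin-strict
    + s * 0ℤ               ≡⟨ ℤP.*-zeroʳ (+ s) ⟩
    0ℤ                     <⟨ proj₁ (shift-between {E} ∣E∣<R 1+w<s) ⟩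
    E + + (suc w ℕ.* R)    ≡⟨ s*Z≡ ⟨
    + s * Z                ∎

  s*Z<s*R : + s * Z < + s * + R
  s*Z<s*R = begin-strict
    + s * Z                ≡⟨ s*Z≡ ⟩
    E + + (suc w ℕ.* R)    <⟨ proj₂ (shift-between {E} ∣E∣<R 1+w<s) ⟩
    + (s ℕ.* R)            ≡⟨ ℤP.pos-* s R ⟩
    + s * + R              ∎

-- For 0 < |j| < s write
-- j = w p q - s m with a nonzero digit w < s (residue-nonzero); then with u = k - m
--   k r + β p q + j = r u + (β + m + w) p q   and   k s + j = s u + w p q,
-- and β + m + w is a base-r digit as long as |β| ≤ ⌊p q / s⌋, so χ-scaled applies.
χ-offset-lift : ∀ p q s .{{_ : NonZero s}} → Coprime s (p ℕ.* q) →
  ∀ k β → ∣ β ∣ ℕ.≤ (p ℕ.* q) ℕ./ s → ∀ j → j ≢ 0ℤ → ∣ j ∣ ℕ.< s →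
  χ p q (p ℕ.* q ℕ.+ s) (k * + (p ℕ.* q ℕ.+ s) + β * + (p ℕ.* q) + j) ≡ χ p q s (k * + s + j)
χ-offset-lift p q s s⊥pq k β ∣β∣≤P/s j j≢0 ∣j∣<s = lift (residue-nonzero s⊥pq j j≢0 ∣j∣<s)
  where
  open ≡-Reasoning
  P R : ℕ
  P = p ℕ.* q
  R = P ℕ.+ s
  ring₁ : ∀ k β m W P S → k * (P + S) + β * P + (W * P - S * m) ≡ (P + S) * (k - m) + (β + m + W) * P
  ring₁ = ℤRing.solve-∀
  ring₂ : ∀ k m W P S → k * S + (W * P - S * m) ≡ S * (k - m) + W * P
  ring₂ = ℤRing.solve-∀
  lift : (∃[ w ] ∃[ m ] suc w ℕ.< s × j ≡ + suc w * + P - + s * m) →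
    χ p q R (k * + R + β * + P + j) ≡ χ p q s (k * + s + j)
  lift (w , m , 1+w<s , j≡) = begin
    χ p q R (k * + R + β * + P + j)
      ≡⟨ cong (χ p q R) (trans (cong (λ i → k * + R + β * + P + i) j≡) (ring₁ k β m (+ suc w) (+ P) (+ s))) ⟩
    χ p q R (+ R * (k - m) + (β + m + + suc w) * + P)
      ≡⟨ χ-scaled p q (k - m) (coprime-+ s⊥pq) s⊥pq (carry-digit P β m w j ∣β∣≤P/s ∣j∣<s 1+w<s j≡)
           (+≤+ z≤n , +<+ 1+w<s) ⟩
    χ p q s (+ s * (k - m) + + suc w * + P)
      ≡⟨ cong (χ p q s) (trans (cong (λ i → k * + s + i) j≡) (ring₂ k m (+ suc w) (+ P) (+ s))) ⟨
    χ p q s (k * + s + j) ∎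

-- Moving the window near k s down by p q does not change χ' at offsets 0 < |j| < s:
-- with j = (w+1) p q - s m,  k s + j = s u + (w+1) p q  and  k s - p q + j = s u + w p q.
χ-offset-shift : ∀ p q s .{{_ : NonZero s}} → Coprime s (p ℕ.* q) →
  ∀ k j → j ≢ 0ℤ → ∣ j ∣ ℕ.< s →
  χ p q s (k * + s + j) ≡ χ p q s (k * + s - + (p ℕ.* q) + j)
χ-offset-shift p q s s⊥pq k j j≢0 ∣j∣<s = shift (residue-nonzero s⊥pq j j≢0 ∣j∣<s)
  where
  open ≡-Reasoning
  P : ℕ
  P = p ℕ.* q
  ring₁ : ∀ k m W P S → k * S + ((1ℤ + W) * P - S * m) ≡ S * (k - m) + (1ℤ + W) * P
  ring₁ = ℤRing.solve-∀
  ring₂ : ∀ k m W P S → k * S - P + ((1ℤ + W) * P - S * m) ≡ S * (k - m) + W * P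
  ring₂ = ℤRing.solve-∀
  shift : (∃[ w ] ∃[ m ] suc w ℕ.< s × j ≡ + suc w * + P - + s * m) →
    χ p q s (k * + s + j) ≡ χ p q s (k * + s - + P + j)
  shift (w , m , 1+w<s , j≡) = begin
    χ p q s (k * + s + j)
      ≡⟨ cong (χ p q s) (trans (cong (λ i → k * + s + i) j≡) (ring₁ k m (+ w) (+ P) (+ s))) ⟩
    χ p q s (+ s * (k - m) + + suc w * + P)
      ≡⟨ χ-scaled p q (k - m) s⊥pq s⊥pq (+≤+ z≤n , +<+ 1+w<s) (+≤+ z≤n , +<+ (ℕP.<-trans (ℕP.n<1+n w) 1+w<s)) ⟩
    χ p q s (+ s * (k - m) + + w * + P)
      ≡⟨ cong (χ p q s) (trans (cong (λ i → k * + s - + P + i) j≡) (ring₂ k m (+ w) (+ P) (+ s))) ⟨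
    χ p q s (k * + s - + P + j) ∎

-- For |k| < p q the integer k s - p q = s (k - p q) + (s-1) p q is not {p,q,s}-representable.
χ-below-vanishes : ∀ p q s .{{_ : NonZero s}} → Coprime s (p ℕ.* q) →
  ∀ k → ∣ k ∣ ℕ.< p ℕ.* q → χ p q s (k * + s - + (p ℕ.* q)) ≡ 0
χ-below-vanishes p q (suc s) s⊥pq k ∣k∣<P = begin
  χ p q (suc s) (k * + suc s - + P)
    ≡⟨ cong (χ p q (suc s)) (ring k (+ s) (+ P)) ⟩
  χ p q (suc s) (+ suc s * (k - + P) + + s * + P)
    ≡⟨ χ-scaled-negative p q (k - + P) s⊥pq (+≤+ z≤n , +<+ (ℕP.n<1+n s)) k-P<0 ⟩
  0 ∎
  where
  open ≡-Reasoning
  P : ℕ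
  P = p ℕ.* q
  ring : ∀ k S P → k * (1ℤ + S) - P ≡ (1ℤ + S) * (k - P) + S * P
  ring = ℤRing.solve-∀
  k-P<0 : k - + P < 0ℤ
  k-P<0 = ℤP.<-≤-trans (ℤP.+-monoˡ-< (- + P) (proj₂ (abs-bounds {k} ∣k∣<P)))
                       (ℤP.≤-reflexive (ℤP.+-inverseʳ (+ P)))

σ-cong : ∀ {p q t t' M M'} n → (∀ i → i ℕ.< n → χ p q t (M - + i) ≡ χ p q t' (M' - + i)) →
  σ p q t n M ≡ σ p q t' n M'
σ-cong zero    _     = refl
σ-cong (suc n) agree = cong₂ ℕ._+_ (agree n (ℕP.n<1+n n)) (σ-cong n (λ i i<n → agree i (ℕP.m<n⇒m<1+n i<n)))

σ-exchange : ∀ {p q t t' M M' γ} n → γ ℕ.< n →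
  (∀ i → i ℕ.< n → i ≢ γ → χ p q t (M - + i) ≡ χ p q t' (M' - + i)) →
  σ p q t n M ℕ.+ χ p q t' (M' - + γ) ≡ σ p q t' n M' ℕ.+ χ p q t (M - + γ)
σ-exchange {p} {q} {t} {t'} {M} {M'} {γ} (suc n) γ<1+n agree with γ ℕ.≟ n
... | yes refl = begin
  a ℕ.+ σ p q t γ M ℕ.+ b    ≡⟨ cong (λ x → a ℕ.+ x ℕ.+ b) rest ⟩
  a ℕ.+ σ p q t' γ M' ℕ.+ b  ≡⟨ ring a (σ p q t' γ M') b ⟩
  b ℕ.+ σ p q t' γ M' ℕ.+ a  ∎
  where
  open ≡-Reasoning
  a b : ℕ
  a = χ p q t (M - + γ)
  b = χ p q t' (M' - + γ)
  rest : σ p q t γ M ≡ σ p q t' γ M'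
  rest = σ-cong γ (λ i i<γ → agree i (ℕP.m<n⇒m<1+n i<γ) (ℕP.<⇒≢ i<γ))
  ring : ∀ a x b → a ℕ.+ x ℕ.+ b ≡ b ℕ.+ x ℕ.+ a
  ring = ℕRing.solve-∀
... | no γ≢n = begin
  χ p q t (M - + n) ℕ.+ σ p q t n M ℕ.+ χ p q t' (M' - + γ)
    ≡⟨ ℕP.+-assoc (χ p q t (M - + n)) _ _ ⟩
  χ p q t (M - + n) ℕ.+ (σ p q t n M ℕ.+ χ p q t' (M' - + γ))
    ≡⟨ cong₂ ℕ._+_ (agree n (ℕP.n<1+n n) (γ≢n ∘ sym)) (σ-exchange n γ<n (λ i i<n → agree i (ℕP.m<n⇒m<1+n i<n))) ⟩
  χ p q t' (M' - + n) ℕ.+ (σ p q t' n M' ℕ.+ χ p q t (M - + γ))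
    ≡⟨ ℕP.+-assoc (χ p q t' (M' - + n)) _ _ ⟨
  χ p q t' (M' - + n) ℕ.+ σ p q t' n M' ℕ.+ χ p q t (M - + γ) ∎
  where
  open ≡-Reasoning
  γ<n : γ ℕ.< n
  γ<n = ℕP.≤∧≢⇒< (ℕP.≤-pred γ<1+n) γ≢n

exchange-difference : ∀ a b c d → a ℕ.+ d ≡ c ℕ.+ b → + a - + b ≡ + c - + d
exchange-difference a b c d a+d≡c+b = begin
  + a - + b                      ≡⟨ ring₁ (+ a) (+ b) (+ d) ⟩
  (+ a + + d) - (+ b + + d)      ≡⟨ cong (λ x → + x - (+ b + + d)) a+d≡c+b ⟩
  (+ c + + b) - (+ b + + d)      ≡⟨ ring₂ (+ b) (+ c) (+ d) ⟩
  + c - + d                      ∎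
  where
  open ≡-Reasoning
  ring₁ : ∀ a b d → a - b ≡ (a + d) - (b + d)
  ring₁ = ℤRing.solve-∀
  ring₂ : ∀ b c d → (c + b) - (b + d) ≡ c - d
  ring₂ = ℤRing.solve-∀

offset-bounds : ∀ {s γ i} → γ ℕ.< s → i ℕ.< s → i ≢ γ → + γ - + i ≢ 0ℤ × ∣ + γ - + i ∣ ℕ.< s
offset-bounds {γ = γ} {i} γ<s i<s i≢γ =
  (λ γ-i≡0 → i≢γ (sym (ℤP.+-injective (ℤP.i-j≡0⇒i≡j (+ γ) (+ i) γ-i≡0)))) , distance-< γ<s i<s

window-exchange : ∀ p q t t' s A A' γ → γ ℕ.< s →
  (∀ j → j ≢ 0ℤ → ∣ j ∣ ℕ.< s → χ p q t (A + j) ≡ χ p q t' (A' + j)) →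
  + σ p q t s (A + + γ) - + χ p q t A ≡ + σ p q t' s (A' + + γ) - + χ p q t' A'
window-exchange p q t t' s A A' γ γ<s agree =
  subst₂ (λ x y → + σ p q t s (A + + γ) - + x ≡ + σ p q t' s (A' + + γ) - + y)
    (cong (χ p q t) (centre A)) (cong (χ p q t') (centre A'))
    (exchange-difference (σ p q t s (A + + γ)) (χ p q t (A + + γ - + γ))
                         (σ p q t' s (A' + + γ)) (χ p q t' (A' + + γ - + γ))
      (σ-exchange {p} {q} {t} {t'} {A + + γ} {A' + + γ} s γ<s agree-off-γ))
  where
  at-offset : ∀ A i → A + + γ - + i ≡ A + (+ γ - + i)
  at-offset A i = ring A (+ γ) (+ i)
    where
    ring : ∀ A g i → A + g - i ≡ A + (g - i)
    ring = ℤRing.solve-∀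
  centre : ∀ A → A + + γ - + γ ≡ A
  centre A = ring A (+ γ)
    where
    ring : ∀ A g → A + g - g ≡ A
    ring = ℤRing.solve-∀
  agree-off-γ : ∀ i → i ℕ.< s → i ≢ γ → χ p q t (A + + γ - + i) ≡ χ p q t' (A' + + γ - + i)
  agree-off-γ i i<s i≢γ with j≢0 , ∣j∣<s ← offset-bounds γ<s i<s i≢γ =
    subst₂ (λ x y → χ p q t x ≡ χ p q t' y) (sym (at-offset A i)) (sym (at-offset A' i))
      (agree (+ γ - + i) j≢0 ∣j∣<s)

-- The theorem.
lemma10 : (p q s : ℕ) → .{{_ : NonZero s}} →
    3 ℕ.≤ p → p ℕ.< q → Coprime p q →
    3 ℕ.≤ s → s ℕ.< q → Coprime s (p ℕ.* q) →
    (k : ℤ) (γ : ℕ) (β : ℤ) →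
    ∣ k ∣ ℕ.< p ℕ.* q → γ ℕ.< s → ∣ β ∣ ℕ.≤ (p ℕ.* q) ℕ./ s →
    let r = p ℕ.* q ℕ.+ s in
    ((+ σ p q r s (k ℤ.* + r ℤ.+ + γ ℤ.+ β ℤ.* + (p ℕ.* q)) ℤ.- + χ p q r (k ℤ.* + r ℤ.+ β ℤ.* + (p ℕ.* q)))
      ≡ (+ σ p q s s (k ℤ.* + s ℤ.+ + γ) ℤ.- + χ p q s (k ℤ.* + s)))
    × ((+ σ p q s s (k ℤ.* + s ℤ.+ + γ) ℤ.- + χ p q s (k ℤ.* + s))
      ≡ + σ p q s s (k ℤ.* + s ℤ.+ + γ ℤ.- + (p ℕ.* q)))
lemma10 p q s _ _ _ _ _ s⊥pq k γ β ∣k∣<pq γ<s ∣β∣≤pq/s = lifted , shifted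
  where
  open ≡-Reasoning
  P r : ℕ
  P = p ℕ.* q
  r = P ℕ.+ s
  lifted : + σ p q r s (k * + r + + γ + β * + P) - + χ p q r (k * + r + β * + P)
         ≡ + σ p q s s (k * + s + + γ) - + χ p q s (k * + s)
  lifted = begin
    + σ p q r s (k * + r + + γ + β * + P) - + χ p q r (k * + r + β * + P)
      ≡⟨ cong (λ M → + σ p q r s M - + χ p q r (k * + r + β * + P)) (ring (k * + r) (+ γ) (β * + P)) ⟩
    + σ p q r s (k * + r + β * + P + + γ) - + χ p q r (k * + r + β * + P)
      ≡⟨ window-exchange p q r s s (k * + r + β * + P) (k * + s) γ γ<s (χ-offset-lift p q s s⊥pq k β ∣β∣≤pq/s) ⟩
    + σ p q s s (k * + s + + γ) - + χ p q s (k * + s) ∎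
    where
    ring : ∀ a g b → a + g + b ≡ a + b + g
    ring = ℤRing.solve-∀
  shifted : + σ p q s s (k * + s + + γ) - + χ p q s (k * + s) ≡ + σ p q s s (k * + s + + γ - + P)
  shifted = begin
    + σ p q s s (k * + s + + γ) - + χ p q s (k * + s)
      ≡⟨ window-exchange p q s s s (k * + s) (k * + s - + P) γ γ<s (χ-offset-shift p q s s⊥pq k) ⟩
    + σ p q s s (k * + s - + P + + γ) - + χ p q s (k * + s - + P)
      ≡⟨ cong₂ (λ M c → + σ p q s s M - + c) (ring (k * + s) (+ P) (+ γ)) (χ-below-vanishes p q s s⊥pq k ∣k∣<pq) ⟩
    + σ p q s s (k * + s + + γ - + P) - + 0
      ≡⟨ ℤP.+-identityʳ (+ σ p q s s (k * + s + + γ - + P)) ⟩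
    + σ p q s s (k * + s + + γ - + P) ∎
    where
    ring : ∀ a P g → a - P + g ≡ a + g - P
    ring = ℤRing.solve-∀
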